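{- Let $n$ be a positive integer, $R = \{n-1, n\}$, and $m \in \{2,3,\ldots,n-2\}$. Then the restricted incomplete rotator graph $\mathrm{Rot}_n(R,m)$ is not strongly connected.
   Context: $\Pi_n$ is the set of strings $a_1 \cdots a_n$ that are permutations of $\{1,\ldots,n\}$. For $2 \le r \le n$, the prefix-rotation $\sigma_r$ maps $a_1 \cdots a_n$ to $a_2 \cdots a_r a_1 a_{r+1} \cdots a_n$. For $R \subseteq \{2,\ldots,n\}$ and $m \in \{1,\ldots,n\}$, $\mathrm{Rot}_n(R,m)$ is the directed graph whose nodes are the strings of $\Pi_n$ whose last symbol is at most $m$, with an arc from $\mathbf{a}$ to $\mathbf{b}$ whenever both are nodes and $\mathbf{b} = \mathbf{a}\sigma_r$ for some $r \in R$. -}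

module Defs where

open import Data.Nat using (ℕ; zero; suc; _≤_; _∸_)
open import Data.List using (List; []; _∷_; _++_; take; drop; applyUpTo; last)
open import Data.List.Relation.Binary.Permutation.Propositional using (_↭_)
open import Data.Maybe using (just)
open import Data.Product using (_×_; ∃)
open import Data.Sum using (_⊎_)
open import Relation.Binary.PropositionalEquality using (_≡_)
open import Relation.Binary.Construct.Closure.ReflexiveTransitive using (Star)

-- Strings are lists of naturals; Π_n = permutations of 1 ⋯ n.
IsPerm : ℕ → List ℕ → Set
IsPerm n a = a ↭ applyUpTo suc n

-- prefix rotation σ_r : a₁ ⋯ aₙ ↦ a₂ ⋯ a_r a₁ a_{r+1} ⋯ aₙ
σ : ℕ → List ℕ → List ℕ
σ r []       = []
σ r (x ∷ xs) = take (r ∸ 1) xs ++ (x ∷ drop (r ∸ 1) xs)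

Node : ℕ → ℕ → List ℕ → Set
Node n m a = IsPerm n a × ∃ λ x → last a ≡ just x × x ≤ m

Arc : ℕ → (ℕ → Set) → ℕ → List ℕ → List ℕ → Set
Arc n R m a b = Node n m a × Node n m b × ∃ λ r → R r × b ≡ σ r a

StronglyConnected : ℕ → (ℕ → Set) → ℕ → Set
StronglyConnected n R m =
  ∀ a b → Node n m a → Node n m b → Star (Arc n R m) a b

R-last2 : ℕ → ℕ → Set
R-last2 n r = (r ≡ n ∸ 1) ⊎ (r ≡ n)

-- In every node reachable by a path, the symbols n-1 and n stay cyclically
-- consecutive (n-1 first) within the first n-1 positions.  Indeed σ_{n-1}
-- cyclically rotates those positions, and σ_n moves the first symbol to the
-- end, where it has to be at most m < n-1; so it is neither n-1 nor n, and
-- removing it from the front keeps n-1 directly before n.  Hence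
-- (n-1) n 2 ⋯ (n-2) 1 does not reach n (n-1) 2 ⋯ (n-2) 1.
module Submission where

open import Defs
open import Data.Nat using (ℕ; suc; _≤_; _<_; _∸_; z≤n; s≤s)
open import Data.Nat.Properties using (≤-trans; <⇒≢; <-irrefl; suc-injective; ≤-<-trans; m<n⇒m<1+n; +-comm)
open import Data.List using (List; []; _∷_; _++_; _∷ʳ_; take; drop; applyUpTo; last; length)
open import Data.List.Properties
  using (++-assoc; ++-identityʳ; length-++; length-applyUpTo; applyUpTo-∷ʳ; ∷-injectiveʳ; ∷ʳ-injectiveˡ)
open import Data.List.Membership.Propositional using (_∈_; _∉_)
open import Data.List.Membership.Propositional.Properties using (∈-++⁺ʳ; ∈-applyUpTo⁻)
open import Data.List.Relation.Unary.Any as Any using ()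
open import Data.List.Relation.Binary.Permutation.Propositional using (_↭_; ↭-refl; ↭-sym; ↭-trans; prep; swap)
open import Data.List.Relation.Binary.Permutation.Propositional.Properties using (↭-length; ∷↭∷ʳ; ++-comm)
open import Data.Maybe using (just)
open import Data.Maybe.Properties using (just-injective)
open import Function using (id; _∘_)
open import Data.Product using (∃; ∃₂; _×_; _,_)
open import Data.Sum using (_⊎_; inj₁; inj₂)
open import Relation.Nullary using (¬_; contradiction)
open import Relation.Binary.PropositionalEquality
open import Relation.Binary.Construct.Closure.ReflexiveTransitive using (Star; ε; _◅_)

private
  variable
    A : Set
    x y b c : A
    xs ys : List A

data Consecutive (b c : A) : List A → Set where
  here  : Consecutive b c (b ∷ c ∷ xs)
  there : Consecutive b c xs → Consecutive b c (x ∷ xs)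

CyclicallyConsecutive : A → A → List A → Set
CyclicallyConsecutive b c xs = Consecutive b c xs ⊎ ∃ λ v → xs ≡ c ∷ v ∷ʳ b

CyclicallyConsecutiveInInit : A → A → List A → Set
CyclicallyConsecutiveInInit b c xs = ∃₂ λ ys w → xs ≡ ys ∷ʳ w × CyclicallyConsecutive b c ys

consecutive-++ʳ : ∀ ys → Consecutive b c xs → Consecutive b c (xs ++ ys)
consecutive-++ʳ ys here      = here
consecutive-++ʳ ys (there p) = there (consecutive-++ʳ ys p)

consecutive-end : ∀ (xs : List A) → Consecutive b c (xs ++ b ∷ c ∷ [])
consecutive-end []       = here
consecutive-end (x ∷ xs) = there (consecutive-end xs)

consecutive⇒∈ : Consecutive b c xs → b ∈ xs
consecutive⇒∈ here      = Any.here refl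
consecutive⇒∈ (there p) = Any.there (consecutive⇒∈ p)

cyclicallyConsecutive-rotate : CyclicallyConsecutive b c (x ∷ xs) → CyclicallyConsecutive b c (xs ∷ʳ x)
cyclicallyConsecutive-rotate (inj₁ here)              = inj₂ (_ , refl)
cyclicallyConsecutive-rotate (inj₁ (there p))         = inj₁ (consecutive-++ʳ _ p)
cyclicallyConsecutive-rotate (inj₂ ([] , refl))       = inj₁ here
cyclicallyConsecutive-rotate {b = b} {c = c} (inj₂ (y ∷ v , refl)) =
  inj₁ (subst (Consecutive b c) (sym (++-assoc (y ∷ v) (b ∷ []) (c ∷ []))) (consecutive-end (y ∷ v)))

cyclicallyConsecutive-uncons : x ≢ b → x ≢ c → CyclicallyConsecutive b c (x ∷ xs) → Consecutive b c xs
cyclicallyConsecutive-uncons x≢b x≢c (inj₁ here)       = contradiction refl x≢b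
cyclicallyConsecutive-uncons x≢b x≢c (inj₁ (there p))  = p
cyclicallyConsecutive-uncons x≢b x≢c (inj₂ (_ , refl)) = contradiction refl x≢c

take-length-++ : ∀ (xs ys : List A) → take (length xs) (xs ++ ys) ≡ xs
take-length-++ []       ys = refl
take-length-++ (x ∷ xs) ys = cong (x ∷_) (take-length-++ xs ys)

drop-length-++ : ∀ (xs ys : List A) → drop (length xs) (xs ++ ys) ≡ ys
drop-length-++ []       ys = refl
drop-length-++ (x ∷ xs) ys = drop-length-++ xs ys

length-∷ʳ : ∀ (xs : List A) x → length (xs ∷ʳ x) ≡ suc (length xs)
length-∷ʳ xs x = trans (length-++ xs) (+-comm (length xs) 1)

last-∷ʳ : ∀ (xs : List A) x → last (xs ∷ʳ x) ≡ just x
last-∷ʳ []           x = refl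
last-∷ʳ (y ∷ [])     x = refl
last-∷ʳ (y ∷ z ∷ xs) x = last-∷ʳ (z ∷ xs) x

σ-suc-length : ∀ x xs ys → σ (suc (length xs)) (x ∷ xs ++ ys) ≡ xs ++ x ∷ ys
σ-suc-length x xs ys = cong₂ (λ u v → u ++ x ∷ v) (take-length-++ xs ys) (drop-length-++ xs ys)

σ-rotateInit : ∀ x xs w → σ (suc (length xs)) ((x ∷ xs) ∷ʳ w) ≡ (xs ∷ʳ x) ∷ʳ w
σ-rotateInit x xs w = trans (σ-suc-length x xs (w ∷ [])) (sym (++-assoc xs (x ∷ []) (w ∷ [])))

σ-rotateAll : ∀ x xs w → σ (suc (suc (length xs))) ((x ∷ xs) ∷ʳ w) ≡ (xs ∷ʳ w) ∷ʳ x
σ-rotateAll x xs w = begin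
  σ (suc (suc (length xs))) (x ∷ xs ∷ʳ w)         ≡⟨ cong (λ r → σ (suc r) (x ∷ xs ∷ʳ w)) (sym (length-∷ʳ xs w)) ⟩
  σ (suc (length (xs ∷ʳ w))) (x ∷ xs ∷ʳ w)        ≡⟨ cong (λ l → σ (suc (length (xs ∷ʳ w))) (x ∷ l)) (sym (++-identityʳ (xs ∷ʳ w))) ⟩
  σ (suc (length (xs ∷ʳ w))) (x ∷ (xs ∷ʳ w) ++ []) ≡⟨ σ-suc-length x (xs ∷ʳ w) [] ⟩
  (xs ∷ʳ w) ∷ʳ x                                  ∎
  where open ≡-Reasoning

σ-rotateInit-preserves : ∀ {b c : ℕ} x xs w → CyclicallyConsecutive b c (x ∷ xs) →
  CyclicallyConsecutiveInInit b c (σ (suc (length xs)) ((x ∷ xs) ∷ʳ w))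
σ-rotateInit-preserves x xs w cc = xs ∷ʳ x , w , σ-rotateInit x xs w , cyclicallyConsecutive-rotate cc

σ-rotateAll-preserves : ∀ {b c : ℕ} x xs w → x ≢ b → x ≢ c → CyclicallyConsecutive b c (x ∷ xs) →
  CyclicallyConsecutiveInInit b c (σ (suc (suc (length xs))) ((x ∷ xs) ∷ʳ w))
σ-rotateAll-preserves x xs w x≢b x≢c cc =
  xs ∷ʳ w , x , σ-rotateAll x xs w , inj₁ (consecutive-++ʳ _ (cyclicallyConsecutive-uncons x≢b x≢c cc))

length-perm : ∀ {n a} → IsPerm n a → length a ≡ n
length-perm {n} a∈Π = trans (↭-length a∈Π) (length-applyUpTo suc n)

arc-preserves : ∀ {n m a a′} → m < n ∸ 1 → Arc n (R-last2 n) m a a′ →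
  CyclicallyConsecutiveInInit (n ∸ 1) n a → CyclicallyConsecutiveInInit (n ∸ 1) n a′
arc-preserves _ _ ([] , _ , _ , inj₁ ())
arc-preserves _ _ ([] , _ , _ , inj₂ (_ , ()))
arc-preserves m<n∸1 ((a∈Π , _) , (_ , z , last≡ , z≤m) , r , r∈R , refl) (x ∷ xs , w , refl , cc)
  with refl ← trans (sym (length-∷ʳ (x ∷ xs) w)) (length-perm a∈Π)
  with r∈R
... | inj₁ refl = σ-rotateInit-preserves x xs w cc
... | inj₂ refl = σ-rotateAll-preserves x xs w (<⇒≢ x<n∸1) (<⇒≢ (m<n⇒m<1+n x<n∸1)) cc
  where
    x≡z : x ≡ z
    x≡z = just-injective (begin
      just x                                       ≡⟨ sym (last-∷ʳ (xs ∷ʳ w) x) ⟩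
      last ((xs ∷ʳ w) ∷ʳ x)                        ≡⟨ cong last (sym (σ-rotateAll x xs w)) ⟩
      last (σ (suc (suc (length xs))) ((x ∷ xs) ∷ʳ w)) ≡⟨ last≡ ⟩
      just z                                       ∎)
      where open ≡-Reasoning
    x<n∸1 : x < suc (length xs)
    x<n∸1 = ≤-<-trans (subst (_≤ _) (sym x≡z) z≤m) m<n∸1

path-preserves : ∀ {n m a a′} → m < n ∸ 1 → Star (Arc n (R-last2 n) m) a a′ →
  CyclicallyConsecutiveInInit (n ∸ 1) n a → CyclicallyConsecutiveInInit (n ∸ 1) n a′
path-preserves m<n∸1 ε           = id
path-preserves m<n∸1 (arc ◅ arcs) = path-preserves m<n∸1 arcs ∘ arc-preserves m<n∸1 arc

¬cyclicallyConsecutive-swapped : b ≢ c → y ≢ c → b ∉ y ∷ ys →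
  ¬ CyclicallyConsecutive b c (c ∷ b ∷ y ∷ ys)
¬cyclicallyConsecutive-swapped b≢c y≢c b∉ (inj₁ here)               = b≢c refl
¬cyclicallyConsecutive-swapped b≢c y≢c b∉ (inj₁ (there here))       = y≢c refl
¬cyclicallyConsecutive-swapped b≢c y≢c b∉ (inj₁ (there (there p)))  = b∉ (consecutive⇒∈ p)
¬cyclicallyConsecutive-swapped b≢c y≢c b∉ (inj₂ ([] , ()))
¬cyclicallyConsecutive-swapped {b = b} b≢c y≢c b∉ (inj₂ (_ ∷ v , eq)) =
  b∉ (subst (b ∈_) (sym (∷-injectiveʳ (∷-injectiveʳ eq))) (∈-++⁺ʳ v (Any.here refl)))

applyUpTo-suc-∷ʳ² : ∀ n → applyUpTo suc (suc (suc n)) ≡ applyUpTo suc n ++ suc n ∷ suc (suc n) ∷ []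
applyUpTo-suc-∷ʳ² n = begin
  applyUpTo suc (suc (suc n))                     ≡⟨ sym (applyUpTo-∷ʳ suc (suc n)) ⟩
  applyUpTo suc (suc n) ∷ʳ suc (suc n)            ≡⟨ cong (_∷ʳ suc (suc n)) (sym (applyUpTo-∷ʳ suc n)) ⟩
  (applyUpTo suc n ∷ʳ suc n) ∷ʳ suc (suc n)       ≡⟨ ++-assoc (applyUpTo suc n) (suc n ∷ []) (suc (suc n) ∷ []) ⟩
  applyUpTo suc n ++ suc n ∷ suc (suc n) ∷ []     ∎
  where open ≡-Reasoning

-- n = k + 4, and middle = 2 ⋯ (n-2).
module Separated (k : ℕ) where

  n : ℕ
  n = suc (suc (suc (suc k)))

  middle : List ℕ
  middle = applyUpTo (suc ∘ suc) (suc k)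

  source target : List ℕ
  source = (n ∸ 1 ∷ n ∷ middle) ∷ʳ 1
  target = (n ∷ n ∸ 1 ∷ middle) ∷ʳ 1

  source-perm : IsPerm n source
  source-perm = ↭-trans (↭-sym (∷↭∷ʳ 1 (n ∸ 1 ∷ n ∷ middle)))
    (subst (1 ∷ n ∸ 1 ∷ n ∷ middle ↭_) (sym (applyUpTo-suc-∷ʳ² (suc (suc k))))
      (prep 1 (++-comm (n ∸ 1 ∷ n ∷ []) middle)))

  target-perm : IsPerm n target
  target-perm = ↭-trans (swap n (n ∸ 1) ↭-refl) source-perm

  source-node : ∀ {m} → 1 ≤ m → Node n m source
  source-node 1≤m = source-perm , 1 , last-∷ʳ (n ∸ 1 ∷ n ∷ middle) 1 , 1≤m

  target-node : ∀ {m} → 1 ≤ m → Node n m target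
  target-node 1≤m = target-perm , 1 , last-∷ʳ (n ∷ n ∸ 1 ∷ middle) 1 , 1≤m

  source-invariant : CyclicallyConsecutiveInInit (n ∸ 1) n source
  source-invariant = n ∸ 1 ∷ n ∷ middle , 1 , refl , inj₁ here

  n∸1∉middle : n ∸ 1 ∉ middle
  n∸1∉middle n∸1∈ with i , i<1+k , eq ← ∈-applyUpTo⁻ (suc ∘ suc) n∸1∈ =
    <-irrefl (sym (suc-injective (suc-injective eq))) i<1+k

  ¬target-invariant : ¬ CyclicallyConsecutiveInInit (n ∸ 1) n target
  ¬target-invariant (ys , w , eq , cc) with refl ← ∷ʳ-injectiveˡ (n ∷ n ∸ 1 ∷ middle) ys eq =
    ¬cyclicallyConsecutive-swapped (λ ()) (λ ()) n∸1∉middle cc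

proposition1 : ∀ (n m : ℕ) → 1 ≤ n → 2 ≤ m → m ≤ n ∸ 2 →
    ¬ StronglyConnected n (R-last2 n) m
proposition1 0 _ _ (s≤s (s≤s _)) ()
proposition1 1 _ _ (s≤s (s≤s _)) ()
proposition1 2 _ _ (s≤s (s≤s _)) ()
proposition1 3 _ _ (s≤s (s≤s _)) (s≤s ())
proposition1 (suc (suc (suc (suc k)))) m _ 2≤m m≤k+2 strongly-connected =
  ¬target-invariant (path-preserves (s≤s m≤k+2) source↝target source-invariant)
  where
    open Separated k
    1≤m : 1 ≤ m
    1≤m = ≤-trans (s≤s z≤n) 2≤m
    source↝target : Star (Arc n (R-last2 n) m) source target
    source↝target = strongly-connected source target
      (source-node 1≤m) (target-node 1≤m)
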